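{- Let $n, r\in \mathbb{N}_0$. If $r = 0$, then $X_{n;0} = n+1$ deterministically. For $r > 0$, every binary tree of size $n$ satisfies \[ [\![ n > 0 \text{ and } r = 1]\!] \leq X_{n;r} \leq \Big\lfloor \frac{n+1}{2^{r}} \Big\rfloor, \] and these bounds are sharp, i.e. for each $n$ both bounds are attained by some binary tree of size $n$.
   Context: A binary tree is either a leaf $\square$ or an inner node with an ordered pair of binary subtrees; its size is the number of inner nodes. The register function is defined by $\mathrm{Reg}(\square)=0$ and, for a tree with subtrees $t_1,t_2$, $\mathrm{Reg}(t)=\max\{\mathrm{Reg}(t_1),\mathrm{Reg}(t_2)\}$ if these differ and $\mathrm{Reg}(t_1)+1$ otherwise. Label every node (inner node or leaf) of a tree by the register function of the subtree rooted at that node. An $r$-branch is a maximal connected set of nodes all labeled $r$ (such a set is a chain). $X_{n;r}$ denotes the number of $r$-branches of a binary tree of size $n$ (as a random variable on the set of binary trees of size $n$). $[\![P]\!]$ is $1$ if $P$ holds and $0$ otherwise. -}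

module Defs where

open import Data.Nat using (ℕ; zero; suc; _+_; _/_; _^_; _⊔_)
open import Data.Nat.Properties using (m^n≢0; _≟_)
open import Data.Bool using (Bool; true; false; _∧_; not)
open import Data.Maybe using (Maybe; just; nothing)
open import Relation.Nullary.Decidable using (⌊_⌋)

data Tree : Set where
  leaf : Tree
  node : Tree → Tree → Tree

size : Tree → ℕ
size leaf = 0
size (node t₁ t₂) = suc (size t₁ + size t₂)

Reg : Tree → ℕ
Reg leaf = 0
Reg (node t₁ t₂) with ⌊ Reg t₁ ≟ Reg t₂ ⌋
... | true  = suc (Reg t₁)
... | false = Reg t₁ ⊔ Reg t₂

[_] : Bool → ℕ
[ true ] = 1
[ false ] = 0

-- A node "starts" an r-branch iff its label is r and its parent (if any)
-- is not labelled r.  Labels of nodes lie on chains, so every r-branch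
-- (maximal connected set of r-labelled nodes) has exactly one topmost node;
-- hence the number of r-branches is the number of such starting nodes.
-- branchesFrom r p t : number of r-branch tops in subtree t, whose parent label is p
-- (nothing = t is the root).
parentNot : ℕ → Maybe ℕ → Bool
parentNot r nothing = true
parentNot r (just p) = not ⌊ p ≟ r ⌋

branchesFrom : ℕ → Maybe ℕ → Tree → ℕ
branchesFrom r p leaf = [ ⌊ Reg leaf ≟ r ⌋ ∧ parentNot r p ]
branchesFrom r p t@(node t₁ t₂) =
  [ ⌊ Reg t ≟ r ⌋ ∧ parentNot r p ]
  + branchesFrom r (just (Reg t)) t₁
  + branchesFrom r (just (Reg t)) t₂

X : ℕ → Tree → ℕ
X r t = branchesFrom r nothing t

divPow2 : ℕ → ℕ → ℕ
divPow2 m r = _/_ m (2 ^ r) {{m^n≢0 2 r}}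

lowerBound : ℕ → ℕ → ℕ
lowerBound zero r = 0
lowerBound (suc n) r = [ ⌊ r ≟ 1 ⌋ ]

{-# OPTIONS --safe #-}
-- Labels never increase towards the leaves, so distinct r-branches start at the
-- roots of disjoint subtrees of register r, each of which has at least 2^r
-- leaves; counting leaves gives the upper bound.  Going down from a node into a
-- child of largest register lowers the label by at most one, so every
-- r ≤ Reg t occurs as a label, and a nonempty tree has register ≥ 1.  The
-- bounds are attained by a left comb (all labels ≤ 1) and by a right comb of
-- ⌊(n+1)/2^r⌋ perfect trees of height r, the last one padded with the
-- remaining leaves.
module Submission where

open import Defs
open import Data.Nat using (ℕ; zero; suc; _+_; _*_; _^_; _⊔_; _/_; _%_; _≤_; _<_; z≤n; s≤s; z<s; s≤s⁻¹)
open import Data.Nat.Properties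
open import Data.Nat.DivMod using (m≡m%n+[m/n]*n; m*n/n≡m; /-monoˡ-≤)
open import Data.Bool using (true; false; _∧_)
open import Data.Maybe using (just; nothing)
open import Data.Product using (_×_; Σ; _,_)
open import Data.Sum using (_⊎_; inj₁; inj₂)
open import Function using (_∘_; case_of_)
open import Relation.Nullary using (yes; no; contradiction)
open import Relation.Nullary.Decidable using (⌊_⌋)
open import Relation.Binary.PropositionalEquality hiding ([_])

open ≤-Reasoning

private
  variable
    r n : ℕ
    t : Tree

Reg-node-≡ : ∀ t₁ t₂ → Reg t₁ ≡ Reg t₂ → Reg (node t₁ t₂) ≡ suc (Reg t₁)
Reg-node-≡ t₁ t₂ eq with Reg t₁ ≟ Reg t₂
... | yes _  = refl
... | no neq = contradiction eq neq

Reg-node-≢ : ∀ t₁ t₂ → Reg t₁ ≢ Reg t₂ → Reg (node t₁ t₂) ≡ Reg t₁ ⊔ Reg t₂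
Reg-node-≢ t₁ t₂ neq with Reg t₁ ≟ Reg t₂
... | yes eq = contradiction eq neq
... | no _   = refl

Reg≤Reg-nodeˡ : ∀ t₁ t₂ → Reg t₁ ≤ Reg (node t₁ t₂)
Reg≤Reg-nodeˡ t₁ t₂ with Reg t₁ ≟ Reg t₂
... | yes _ = n≤1+n _
... | no _  = m≤m⊔n _ _

Reg≤Reg-nodeʳ : ∀ t₁ t₂ → Reg t₂ ≤ Reg (node t₁ t₂)
Reg≤Reg-nodeʳ t₁ t₂ with Reg t₁ ≟ Reg t₂
... | yes eq = ≤-trans (≤-reflexive (sym eq)) (n≤1+n _)
... | no _   = m≤n⊔m _ _

Reg<Reg-nodeˡ : ∀ t₁ t₂ → Reg t₁ ≤ Reg t₂ → Reg t₁ < Reg (node t₁ t₂)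
Reg<Reg-nodeˡ t₁ t₂ le with Reg t₁ ≟ Reg t₂
... | yes _  = n<1+n _
... | no neq = <-≤-trans (≤∧≢⇒< le neq) (m≤n⊔m _ _)

0<Reg-node : ∀ t₁ t₂ → 0 < Reg (node t₁ t₂)
0<Reg-node t₁ t₂ with Reg t₁ ≟ Reg t₂
... | yes _  = z<s
... | no neq = m≢n⇒0<m⊔n neq
  where
  m≢n⇒0<m⊔n : ∀ {m n} → m ≢ n → 0 < m ⊔ n
  m≢n⇒0<m⊔n {zero}  {zero}  neq = contradiction refl neq
  m≢n⇒0<m⊔n {zero}  {suc _} _   = z<s
  m≢n⇒0<m⊔n {suc m} {n}     _   = ≤-trans z<s (m≤m⊔n (suc m) n)

<Reg-node⇒≤Reg-child : ∀ t₁ t₂ → r < Reg (node t₁ t₂) → r ≤ Reg t₁ ⊎ r ≤ Reg t₂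
<Reg-node⇒≤Reg-child {r} t₁ t₂ r< with Reg t₁ ≟ Reg t₂
... | yes _ = inj₁ (s≤s⁻¹ r<)
... | no _  with ⊔-sel (Reg t₁) (Reg t₂)
...   | inj₁ eq = inj₁ (<⇒≤ (subst (r <_) eq r<))
...   | inj₂ eq = inj₂ (<⇒≤ (subst (r <_) eq r<))

Reg-node-leaf : ∀ t → 0 < Reg t → Reg (node t leaf) ≡ Reg t
Reg-node-leaf t pos = trans (Reg-node-≢ t leaf (<⇒≢ pos ∘ sym)) (⊔-identityʳ _)

leaves : Tree → ℕ
leaves leaf         = 1
leaves (node t₁ t₂) = leaves t₁ + leaves t₂

leaves≡suc-size : ∀ t → leaves t ≡ suc (size t)
leaves≡suc-size leaf         = refl
leaves≡suc-size (node t₁ t₂) =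
  trans (cong₂ _+_ (leaves≡suc-size t₁) (leaves≡suc-size t₂)) (cong suc (+-suc (size t₁) (size t₂)))

size≡⇒leaves≡ : size t ≡ n → leaves t ≡ n + 1
size≡⇒leaves≡ {t} {n} refl = trans (leaves≡suc-size t) (+-comm 1 n)

leaves≡⇒size≡ : leaves t ≡ n + 1 → size t ≡ n
leaves≡⇒size≡ {t} {n} eq = suc-injective (trans (sym (leaves≡suc-size t)) (trans eq (+-comm n 1)))

2^Reg≤leaves : ∀ t → 2 ^ Reg t ≤ leaves t
2^Reg≤leaves leaf = ≤-refl
2^Reg≤leaves (node t₁ t₂) with Reg t₁ ≟ Reg t₂
... | yes eq = +-mono-≤ (2^Reg≤leaves t₁) (begin
  2 ^ Reg t₁ + 0 ≡⟨ +-identityʳ _ ⟩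
  2 ^ Reg t₁     ≡⟨ cong (2 ^_) eq ⟩
  2 ^ Reg t₂     ≤⟨ 2^Reg≤leaves t₂ ⟩
  leaves t₂      ∎)
... | no _ = begin
  2 ^ (Reg t₁ ⊔ Reg t₂)     ≡⟨ mono-≤-distrib-⊔ {2 ^_} (^-monoʳ-≤ 2) (Reg t₁) (Reg t₂) ⟩
  2 ^ Reg t₁ ⊔ 2 ^ Reg t₂   ≤⟨ m⊔n≤m+n (2 ^ Reg t₁) (2 ^ Reg t₂) ⟩
  2 ^ Reg t₁ + 2 ^ Reg t₂   ≤⟨ +-mono-≤ (2^Reg≤leaves t₁) (2^Reg≤leaves t₂) ⟩
  leaves t₁ + leaves t₂     ∎

[≟∧]-≢ : ∀ {a} b → a ≢ r → [ ⌊ a ≟ r ⌋ ∧ b ] ≡ 0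
[≟∧]-≢ {r} {a} b neq with a ≟ r
... | yes eq = contradiction eq neq
... | no _   = refl

[≟∧]-refl : ∀ a b → [ ⌊ a ≟ a ⌋ ∧ b ] ≡ [ b ]
[≟∧]-refl a b with a ≟ a
... | yes _  = refl
... | no neq = contradiction refl neq

[∧false] : ∀ b → [ b ∧ false ] ≡ 0
[∧false] true  = refl
[∧false] false = refl

parentNot-refl : ∀ r → parentNot r (just r) ≡ false
parentNot-refl r with r ≟ r
... | yes _  = refl
... | no neq = contradiction refl neq

parentNot-≢ : ∀ {p} → p ≢ r → parentNot r (just p) ≡ true
parentNot-≢ {r} {p} neq with p ≟ r
... | yes eq = contradiction eq neq
... | no _   = refl

branchesFrom-parent≢ : ∀ {p} t → p ≢ r → branchesFrom r (just p) t ≡ X r t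
branchesFrom-parent≢ leaf         neq rewrite parentNot-≢ neq = refl
branchesFrom-parent≢ (node t₁ t₂) neq rewrite parentNot-≢ neq = refl

branchesFrom-< : ∀ p t → Reg t < r → branchesFrom r p t ≡ 0
branchesFrom-< p leaf         Reg<r = [≟∧]-≢ (parentNot _ p) (<⇒≢ Reg<r)
branchesFrom-< p (node t₁ t₂) Reg<r = cong₂ _+_
  (cong₂ _+_ ([≟∧]-≢ (parentNot _ p) (<⇒≢ Reg<r))
             (branchesFrom-< _ t₁ (≤-<-trans (Reg≤Reg-nodeˡ t₁ t₂) Reg<r)))
  (branchesFrom-< _ t₂ (≤-<-trans (Reg≤Reg-nodeʳ t₁ t₂) Reg<r))

-- Below an r-labelled node, an r-labelled node continues its parent's branch.
branchesFrom-under : ∀ t → Reg t ≤ r → branchesFrom r (just r) t ≡ 0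
branchesFrom-under {r} t Reg≤r with Reg t ≟ r
... | no neq = branchesFrom-< (just r) t (≤∧≢⇒< Reg≤r neq)
branchesFrom-under {r} leaf Reg≤r | yes _ rewrite parentNot-refl r = [∧false] _
branchesFrom-under {r} (node t₁ t₂) Reg≤r | yes refl rewrite parentNot-refl r = cong₂ _+_
  (cong₂ _+_ ([∧false] _) (branchesFrom-under t₁ (Reg≤Reg-nodeˡ t₁ t₂)))
  (branchesFrom-under t₂ (Reg≤Reg-nodeʳ t₁ t₂))

X-< : ∀ t → Reg t < r → X r t ≡ 0
X-< = branchesFrom-< nothing

X-Reg : ∀ t → Reg t ≡ r → X r t ≡ 1
X-Reg leaf         refl = refl
X-Reg (node t₁ t₂) refl = cong₂ _+_
  (cong₂ _+_ ([≟∧]-refl _ true) (branchesFrom-under t₁ (Reg≤Reg-nodeˡ t₁ t₂)))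
  (branchesFrom-under t₂ (Reg≤Reg-nodeʳ t₁ t₂))

X-node-≢ : ∀ t₁ t₂ → Reg (node t₁ t₂) ≢ r → X r (node t₁ t₂) ≡ X r t₁ + X r t₂
X-node-≢ t₁ t₂ neq = cong₂ _+_
  (cong₂ _+_ ([≟∧]-≢ true neq) (branchesFrom-parent≢ t₁ neq))
  (branchesFrom-parent≢ t₂ neq)

X-0≡leaves : ∀ t → X 0 t ≡ leaves t
X-0≡leaves leaf         = refl
X-0≡leaves (node t₁ t₂) = trans (X-node-≢ t₁ t₂ (<⇒≢ (0<Reg-node t₁ t₂) ∘ sym))
  (cong₂ _+_ (X-0≡leaves t₁) (X-0≡leaves t₂))

-- Split by case, not with: X r t unfolds to the test Reg t ≟ r, which with would abstract.
X*2^r≤leaves : ∀ r t → X r t * 2 ^ r ≤ leaves t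
X*2^r≤leaves zero    leaf = ≤-refl
X*2^r≤leaves (suc r) leaf = z≤n
X*2^r≤leaves r t@(node t₁ t₂) = case Reg t ≟ r of λ where
  (yes refl) → begin
    X (Reg t) t * 2 ^ Reg t ≡⟨ cong (_* 2 ^ Reg t) (X-Reg t refl) ⟩
    1 * 2 ^ Reg t           ≡⟨ *-identityˡ _ ⟩
    2 ^ Reg t               ≤⟨ 2^Reg≤leaves t ⟩
    leaves t                ∎
  (no neq) → begin
    X r t * 2 ^ r                   ≡⟨ cong (_* 2 ^ r) (X-node-≢ t₁ t₂ neq) ⟩
    (X r t₁ + X r t₂) * 2 ^ r       ≡⟨ *-distribʳ-+ (2 ^ r) (X r t₁) (X r t₂) ⟩
    X r t₁ * 2 ^ r + X r t₂ * 2 ^ r ≤⟨ +-mono-≤ (X*2^r≤leaves r t₁) (X*2^r≤leaves r t₂) ⟩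
    leaves t                        ∎

0<X : ∀ t → r ≤ Reg t → 0 < X r t
0<X leaf z≤n = z<s
0<X {r} t@(node t₁ t₂) r≤Reg = case Reg t ≟ r of λ where
  (yes eq) → ≤-reflexive (sym (X-Reg t eq))
  (no neq) → subst (0 <_) (sym (X-node-≢ t₁ t₂ neq))
    (case <Reg-node⇒≤Reg-child t₁ t₂ (≤∧≢⇒< r≤Reg (neq ∘ sym)) of λ where
      (inj₁ r≤Reg₁) → <-≤-trans (0<X t₁ r≤Reg₁) (m≤m+n _ _)
      (inj₂ r≤Reg₂) → <-≤-trans (0<X t₂ r≤Reg₂) (m≤n+m _ _))

X≤/2^r : ∀ r t → size t ≡ n → X r t ≤ divPow2 (n + 1) r
X≤/2^r {n} r t size≡n = begin
  X r t                 ≡⟨ m*n/n≡m (X r t) (2 ^ r) ⟨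
  X r t * 2 ^ r / 2 ^ r ≤⟨ /-monoˡ-≤ (2 ^ r) (X*2^r≤leaves r t) ⟩
  leaves t / 2 ^ r      ≡⟨ cong (_/ 2 ^ r) (size≡⇒leaves≡ size≡n) ⟩
  (n + 1) / 2 ^ r       ∎
  where instance _ = m^n≢0 2 r

lowerBound≤X : ∀ r t → size t ≡ n → lowerBound n (suc r) ≤ X (suc r) t
lowerBound≤X {zero}  r       t            _  = z≤n
lowerBound≤X {suc n} (suc r) t            _  = z≤n
lowerBound≤X {suc n} zero    leaf         ()
lowerBound≤X {suc n} zero    (node t₁ t₂) _  = 0<X (node t₁ t₂) (0<Reg-node t₁ t₂)

perfect : ℕ → Tree
perfect zero    = leaf
perfect (suc k) = node (perfect k) (perfect k)

Reg-perfect : ∀ k → Reg (perfect k) ≡ k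
Reg-perfect zero    = refl
Reg-perfect (suc k) = trans (Reg-node-≡ (perfect k) (perfect k) refl) (cong suc (Reg-perfect k))

leaves-perfect : ∀ k → leaves (perfect k) ≡ 2 ^ k
leaves-perfect zero    = refl
leaves-perfect (suc k) = cong₂ _+_ (leaves-perfect k) (trans (leaves-perfect k) (sym (+-identityʳ _)))

comb : ℕ → Tree → Tree
comb zero    t = t
comb (suc j) t = node (comb j t) leaf

leaves-comb : ∀ j t → leaves (comb j t) ≡ j + leaves t
leaves-comb zero    t = refl
leaves-comb (suc j) t = trans (+-comm _ 1) (cong suc (leaves-comb j t))

Reg-comb : ∀ j t → 0 < Reg t → Reg (comb j t) ≡ Reg t
Reg-comb zero    t _   = refl
Reg-comb (suc j) t pos =
  trans (Reg-node-leaf (comb j t) (subst (0 <_) (sym (Reg-comb j t pos)) pos)) (Reg-comb j t pos)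

X-node-leaf : ∀ t → 0 < r → 0 < Reg t → X r (node t leaf) ≡ X r t
X-node-leaf {r} t 0<r pos = case Reg t ≟ r of λ where
  (yes eq) → trans (X-Reg (node t leaf) (trans (Reg-node-leaf t pos) eq)) (sym (X-Reg t eq))
  (no neq) → begin-equality
    X r (node t leaf)     ≡⟨ X-node-≢ t leaf (neq ∘ trans (sym (Reg-node-leaf t pos))) ⟩
    X r t + X r leaf      ≡⟨ cong (X r t +_) (X-< leaf 0<r) ⟩
    X r t + 0             ≡⟨ +-identityʳ _ ⟩
    X r t                 ∎

X-comb : ∀ j t → 0 < r → 0 < Reg t → X r (comb j t) ≡ X r t
X-comb zero    t _   _   = refl
X-comb (suc j) t 0<r pos =
  trans (X-node-leaf (comb j t) 0<r (subst (0 <_) (sym (Reg-comb j t pos)) pos)) (X-comb j t 0<r pos)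

stack : Tree → ℕ → Tree → Tree
stack s zero    t = t
stack s (suc q) t = node s (stack s q t)

leaves-stack : ∀ s q t → leaves (stack s q t) ≡ q * leaves s + leaves t
leaves-stack s zero    t = refl
leaves-stack s (suc q) t =
  trans (cong (leaves s +_) (leaves-stack s q t)) (sym (+-assoc (leaves s) _ _))

Reg≤Reg-stack : ∀ s q t → Reg t ≤ Reg (stack s q t)
Reg≤Reg-stack s zero    t = ≤-refl
Reg≤Reg-stack s (suc q) t = ≤-trans (Reg≤Reg-stack s q t) (Reg≤Reg-nodeʳ s (stack s q t))

X-stack : ∀ s q t → Reg s ≡ r → r ≤ Reg t → X r (stack s q t) ≡ q + X r t
X-stack     s zero    t _      _     = refl
X-stack {r} s (suc q) t Reg≡r r≤Reg = begin-equality
  X r (node s (stack s q t))  ≡⟨ X-node-≢ s (stack s q t) (<⇒≢ r<Reg ∘ sym) ⟩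
  X r s + X r (stack s q t)   ≡⟨ cong₂ _+_ (X-Reg s Reg≡r) (X-stack s q t Reg≡r r≤Reg) ⟩
  suc q + X r t               ∎
  where
  Reg-s≤Reg-stack : Reg s ≤ Reg (stack s q t)
  Reg-s≤Reg-stack = ≤-trans (≤-reflexive Reg≡r) (≤-trans r≤Reg (Reg≤Reg-stack s q t))
  r<Reg : r < Reg (node s (stack s q t))
  r<Reg = subst (_< _) Reg≡r (Reg<Reg-nodeˡ s (stack s q t) Reg-s≤Reg-stack)

extremal : ℕ → ℕ → ℕ → Tree
extremal k q m = stack (perfect k) q (comb m (perfect k))

leaves-extremal : ∀ k q m → leaves (extremal k q m) ≡ m + suc q * 2 ^ k
leaves-extremal k q m = begin-equality
  leaves (extremal k q m)                    ≡⟨ leaves-stack (perfect k) q _ ⟩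
  q * P + leaves (comb m (perfect k))        ≡⟨ cong (q * P +_) (leaves-comb m (perfect k)) ⟩
  q * P + (m + P)                            ≡⟨ cong (λ p → q * p + (m + p)) (leaves-perfect k) ⟩
  q * 2 ^ k + (m + 2 ^ k)                    ≡⟨ +-comm (q * 2 ^ k) _ ⟩
  (m + 2 ^ k) + q * 2 ^ k                    ≡⟨ +-assoc m _ _ ⟩
  m + suc q * 2 ^ k                          ∎
  where P = leaves (perfect k)

X-extremal : ∀ k q m → 0 < k → X k (extremal k q m) ≡ suc q
X-extremal k q m 0<k = begin-equality
  X k (extremal k q m)             ≡⟨ X-stack (perfect k) q _ (Reg-perfect k) (≤-reflexive (sym Reg-padded)) ⟩
  q + X k (comb m (perfect k))     ≡⟨ cong (q +_) (X-comb m (perfect k) 0<k Reg-perfect-pos) ⟩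
  q + X k (perfect k)              ≡⟨ cong (q +_) (X-Reg (perfect k) (Reg-perfect k)) ⟩
  q + 1                            ≡⟨ +-comm q 1 ⟩
  suc q                            ∎
  where
  Reg-perfect-pos : 0 < Reg (perfect k)
  Reg-perfect-pos = subst (0 <_) (sym (Reg-perfect k)) 0<k
  Reg-padded : Reg (comb m (perfect k)) ≡ k
  Reg-padded = trans (Reg-comb m (perfect k) Reg-perfect-pos) (Reg-perfect k)

lowerBound-attained : ∀ n r → Σ Tree (λ t → (size t ≡ n) × (X (suc r) t ≡ lowerBound n (suc r)))
lowerBound-attained zero    r = leaf , refl , refl
lowerBound-attained (suc k) r =
  comb k (perfect 1) , leaves≡⇒size≡ (trans (leaves-comb k (perfect 1)) (+-suc k 1)) , X-comb-1 r
  where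
  Reg-comb-1 : Reg (comb k (perfect 1)) ≡ 1
  Reg-comb-1 = Reg-comb k (perfect 1) z<s
  X-comb-1 : ∀ r → X (suc r) (comb k (perfect 1)) ≡ [ ⌊ suc r ≟ 1 ⌋ ]
  X-comb-1 zero    = X-Reg (comb k (perfect 1)) Reg-comb-1
  X-comb-1 (suc r) = X-< (comb k (perfect 1)) (subst (_< suc (suc r)) (sym Reg-comb-1) (s≤s z<s))

upperBound-attained : ∀ n r → Σ Tree (λ t → (size t ≡ n) × (X (suc r) t ≡ divPow2 (n + 1) (suc r)))
upperBound-attained n r with divPow2 (n + 1) (suc r) in q≡
... | zero  = comb n leaf , size≡n ,
  n≤0⇒n≡0 (subst (X (suc r) (comb n leaf) ≤_) q≡ (X≤/2^r (suc r) (comb n leaf) size≡n))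
  where
  size≡n : size (comb n leaf) ≡ n
  size≡n = leaves≡⇒size≡ (leaves-comb n leaf)
... | suc q = extremal (suc r) q m , leaves≡⇒size≡ leaves≡ , X-extremal (suc r) q m z<s
  where
  instance _ = m^n≢0 2 (suc r)
  m = (n + 1) % 2 ^ suc r
  leaves≡ : leaves (extremal (suc r) q m) ≡ n + 1
  leaves≡ = begin-equality
    leaves (extremal (suc r) q m)        ≡⟨ leaves-extremal (suc r) q m ⟩
    m + suc q * 2 ^ suc r                ≡⟨ cong (λ d → m + d * 2 ^ suc r) q≡ ⟨
    m + (n + 1) / 2 ^ suc r * 2 ^ suc r  ≡⟨ m≡m%n+[m/n]*n (n + 1) (2 ^ suc r) ⟨
    n + 1                                ∎

proposition2p5 :
    (n : ℕ) →
    ((t : Tree) → size t ≡ n → X 0 t ≡ n + 1)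
    × ((r : ℕ) →
        ((t : Tree) → size t ≡ n →
           (lowerBound n (suc r) ≤ X (suc r) t) × (X (suc r) t ≤ divPow2 (n + 1) (suc r)))
        × Σ Tree (λ t → (size t ≡ n) × (X (suc r) t ≡ lowerBound n (suc r)))
        × Σ Tree (λ t → (size t ≡ n) × (X (suc r) t ≡ divPow2 (n + 1) (suc r))))
proposition2p5 n =
  (λ t size≡n → trans (X-0≡leaves t) (size≡⇒leaves≡ size≡n)) ,
  λ r → (λ t size≡n → lowerBound≤X r t size≡n , X≤/2^r (suc r) t size≡n) ,
        lowerBound-attained n r ,
        upperBound-attained n r
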